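{- Let $S$ be a language, $D$ a ruleset of $S$ and $X$ a set. If $D$ emulates from $\emptyset$ each of $\{R_=\}$, $\{R_\leftrightarrow\}$ and $\{R_\Rightarrow\}$, and $\mathrm{Prov}_D(X)\subseteq X$, then the relation $\{(t_1,t_2): t_1,t_2$ terms of $S$, $X\vdash_D\ \equiv t_1t_2\}$ is an equivalence relation on the set of terms of $S$.
   Context: A language $S$: integer-valued arity $\#$, equality symbol $\equiv\in\operatorname{dom}\#$ with $\#(\equiv)=-2$, connective $\downarrow\notin\operatorname{dom}\#$; strings concatenated by juxtaposition; terms are literals and $s\,t_1\cdots t_n$ ($\#(s)=n>0$); $\equiv t_1t_2$ is an atomic formula for terms $t_1,t_2$. A sequent is $(\Gamma,\varphi)$ with $\Gamma$ a finite set of formulas; a rule maps sets of sequents to sets of sequents; a ruleset is a set of rules. $O_D(\Sigma)=\bigcup_{R\in D}R(\Sigma)$ with iterates $O_D^n$. $X\vdash_D\varphi$ iff $(\Gamma,\varphi)\in O^n_D(\emptyset)$ for some $n$ and finite $\Gamma\subseteq X$; $\mathrm{Prov}_D(X)=\{\varphi:X\vdash_D\varphi\}$. $D$ emulates $D'$ from $\emptyset$ if $\bigcup_{n\ge1}O^n_{D'}(\emptyset)\subseteq\bigcup_{n\ge1}O^n_D(\emptyset)$. Rules: $R_=(\Sigma)=\{(\emptyset,\equiv tt):t\text{ term}\}$; $R_\leftrightarrow(\Sigma)=\{(\{\equiv t_1t_2\},\equiv t_2t_1)\}$; $R_\Rightarrow(\Sigma)=\{(\{\equiv t_1t_2,\equiv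 t_2t_3\},\equiv t_1t_3)\}$ (all $t_i$ terms). -}

module Defs where

open import Level using (Level; _⊔_) renaming (suc to lsuc; zero to lzero)
open import Data.Nat using (ℕ; zero; suc)
open import Data.Integer using (ℤ; +_; -[1+_])
open import Data.Maybe using (Maybe; just; nothing)
open import Data.List using (List; []; _∷_; _++_; [_]; concat)
open import Data.List.Membership.Propositional using (_∈_)
open import Data.Vec using (Vec; toList)
open import Data.Vec.Relation.Unary.All using (All)
open import Data.Product using (Σ; ∃; ∃-syntax; _×_; _,_; proj₁)
open import Data.Sum using (_⊎_)
open import Data.Empty using (⊥)
open import Data.Unit using (⊤)
open import Function.Bundles using (_⇔_)
open import Relation.Binary.PropositionalEquality using (_≡_)
open import Relation.Unary using (Pred; _⊆_)

record Language : Set₁ where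
  field
    Sym     : Set
    ar      : Sym → Maybe ℤ          -- nothing = not in dom #
    eqSym   : Sym
    eqSym-ar : ar eqSym ≡ just -[1+ 1 ]   -- #(≡) = -2
    down    : Sym
    down-ar : ar down ≡ nothing

module _ (S : Language) where
  open Language S

  Str : Set
  Str = List Sym

  data IsTerm : Str → Set where
    lit : ∀ {s} → ar s ≡ just (+ 0) → IsTerm [ s ]
    app : ∀ {s n} (ts : Vec Str (suc n)) → ar s ≡ just (+ suc n) →
          All IsTerm ts → IsTerm (s ∷ concat (toList ts))

  ≐ : Str → Str → Str
  ≐ t₁ t₂ = eqSym ∷ (t₁ ++ t₂)

  -- a sequent (Γ , φ); the finite set Γ is represented by a list,
  -- read as the finite set of its members
  Sequent : Set
  Sequent = List Str × Str

  SeqSet : Set₁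
  SeqSet = Pred Sequent lzero

  Rule : Set₁
  Rule = SeqSet → SeqSet

  -- a ruleset (set of rules), presented as an indexed family of rules
  -- (the set is the image of the family; avoids an impredicative powerset)
  record Ruleset : Set₁ where
    constructor ruleset
    field
      Idx  : Set
      rule : Idx → Rule

  ∅ : SeqSet
  ∅ _ = ⊥

  O : Ruleset → SeqSet → SeqSet
  O D Σ' sq = ∃[ i ] Ruleset.rule D i Σ' sq

  O^ : Ruleset → ℕ → SeqSet → SeqSet
  O^ D zero    Σ' = Σ'
  O^ D (suc n) Σ' = O D (O^ D n Σ')

  _⊢[_]_ : Pred Str lzero → Ruleset → Str → Set
  X ⊢[ D ] φ = ∃[ n ] ∃[ Γ ] (O^ D n ∅ (Γ , φ) × (∀ {ψ} → ψ ∈ Γ → X ψ))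

  Prov : Ruleset → Pred Str lzero → Pred Str lzero
  Prov D X φ = X ⊢[ D ] φ

  Emulates : Ruleset → Ruleset → Set
  Emulates D D' = ∀ {sq} → (∃[ n ] O^ D' (suc n) ∅ sq) → ∃[ m ] O^ D (suc m) ∅ sq

  ⟦_⟧ : Rule → Ruleset
  ⟦ R ⟧ = ruleset ⊤ (λ _ → R)

  _≈set_ : List Str → (Str → Set) → Set
  Γ ≈set P = ∀ x → (x ∈ Γ) ⇔ P x

  R= : Rule
  R= Σ' (Γ , φ) = ∃[ t ] (IsTerm t × Γ ≈set (λ _ → ⊥) × φ ≡ ≐ t t)

  R↔ : Rule
  R↔ Σ' (Γ , φ) = ∃[ t₁ ] ∃[ t₂ ] (IsTerm t₁ × IsTerm t₂ ×
                    Γ ≈set (λ x → x ≡ ≐ t₁ t₂) × φ ≡ ≐ t₂ t₁)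

  R⇒ : Rule
  R⇒ Σ' (Γ , φ) = ∃[ t₁ ] ∃[ t₂ ] ∃[ t₃ ] (IsTerm t₁ × IsTerm t₂ × IsTerm t₃ ×
                    Γ ≈set (λ x → x ≡ ≐ t₁ t₂ ⊎ x ≡ ≐ t₂ t₃) × φ ≡ ≐ t₁ t₃)

  Term : Set
  Term = Σ Str IsTerm

  EqRel : Ruleset → Pred Str lzero → Term → Term → Set
  EqRel D X t₁ t₂ = X ⊢[ D ] ≐ (proj₁ t₁) (proj₁ t₂)

-- Each of the three equality rules fires in a single step from no premises, so
-- by emulation D derives the sequents  ⊢ ≡tt,  ≡t₁t₂ ⊢ ≡t₂t₁  and
-- ≡t₁t₂, ≡t₂t₃ ⊢ ≡t₁t₃.  Their antecedents are D-provable from X by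
-- assumption, hence lie in X because X is closed under D-provability.
module Submission where

open import Defs
open import Level using (zero)
open import Relation.Unary using (Pred; _⊆_)
open import Relation.Binary.Structures using (IsEquivalence)
open import Data.List using ([]; _∷_; [_])
open import Data.List.Relation.Unary.Any using (here; there)
open import Data.List.Membership.Propositional using (_∈_)
open import Data.Product using (∃-syntax; _,_)
open import Data.Sum using (_⊎_; inj₁; inj₂)
open import Data.Empty using (⊥)
open import Data.Unit using (tt)
open import Data.Nat using (suc)
open import Function.Bundles using (mk⇔)
open import Relation.Binary.PropositionalEquality using (_≡_; refl)

module _ {S : Language} where

  Derivable : Ruleset S → Sequent S → Set
  Derivable D sq = ∃[ n ] O^ S D (suc n) (∅ S) sq

  derivable-⟦⟧ : ∀ R {sq} → R (∅ S) sq → Derivable (⟦_⟧ S R) sq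
  derivable-⟦⟧ R r = 0 , tt , r

  ⊢-intro : ∀ {D X Γ φ} → Derivable D (Γ , φ) → (∀ {ψ} → ψ ∈ Γ → X ψ) → _⊢[_]_ S X D φ
  ⊢-intro (n , d) Γ⊆X = suc n , _ , d , Γ⊆X

  []≈∅ : _≈set_ S [] (λ _ → ⊥)
  []≈∅ _ = mk⇔ (λ ()) (λ ())

  [_]≈singleton : ∀ φ → _≈set_ S [ φ ] (_≡ φ)
  [ φ ]≈singleton _ = mk⇔ (λ { (here e) → e ; (there ()) }) here

  pair≈union : ∀ φ ψ → _≈set_ S (φ ∷ ψ ∷ []) (λ x → x ≡ φ ⊎ x ≡ ψ)
  pair≈union φ ψ _ = mk⇔ (λ { (here e) → inj₁ e ; (there (here e)) → inj₂ e ; (there (there ())) })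
                        (λ { (inj₁ e) → here e ; (inj₂ e) → there (here e) })

  ⊢-refl : ∀ {D X} → Emulates S D (⟦_⟧ S (R= S)) → ∀ {t} → IsTerm S t → _⊢[_]_ S X D (≐ S t t)
  ⊢-refl emul {t} t-term = ⊢-intro (emul (derivable-⟦⟧ (R= S) (t , t-term , []≈∅ , refl))) λ ()

  module _ {D : Ruleset S} {X : Pred (Str S) zero} (closed : Prov S D X ⊆ X) where

    ⊢-sym : Emulates S D (⟦_⟧ S (R↔ S)) → ∀ {t₁ t₂} → IsTerm S t₁ → IsTerm S t₂ →
            _⊢[_]_ S X D (≐ S t₁ t₂) → _⊢[_]_ S X D (≐ S t₂ t₁)
    ⊢-sym emul {t₁} {t₂} t₁-term t₂-term ⊢₁₂ =
      ⊢-intro (emul (derivable-⟦⟧ (R↔ S) (t₁ , t₂ , t₁-term , t₂-term , [ ≐ S t₁ t₂ ]≈singleton , refl)))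
              λ { (here refl) → closed ⊢₁₂ ; (there ()) }

    ⊢-trans : Emulates S D (⟦_⟧ S (R⇒ S)) → ∀ {t₁ t₂ t₃} →
              IsTerm S t₁ → IsTerm S t₂ → IsTerm S t₃ →
              _⊢[_]_ S X D (≐ S t₁ t₂) → _⊢[_]_ S X D (≐ S t₂ t₃) → _⊢[_]_ S X D (≐ S t₁ t₃)
    ⊢-trans emul {t₁} {t₂} {t₃} t₁-term t₂-term t₃-term ⊢₁₂ ⊢₂₃ =
      ⊢-intro (emul (derivable-⟦⟧ (R⇒ S) (t₁ , t₂ , t₃ , t₁-term , t₂-term , t₃-term ,
                                          pair≈union (≐ S t₁ t₂) (≐ S t₂ t₃) , refl)))
              λ { (here refl) → closed ⊢₁₂ ; (there (here refl)) → closed ⊢₂₃ ; (there (there ())) }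

mainTheorem14 : (S : Language) (D : Ruleset S) (X : Pred (Str S) zero) →
    Emulates S D (⟦_⟧ S (R= S)) → Emulates S D (⟦_⟧ S (R↔ S)) → Emulates S D (⟦_⟧ S (R⇒ S)) →
    Prov S D X ⊆ X →
    IsEquivalence (EqRel S D X)
mainTheorem14 S D X emul= emul↔ emul⇒ closed = record
  { refl  = λ { {_ , t} → ⊢-refl emul= t }
  ; sym   = λ { {_ , t₁} {_ , t₂} → ⊢-sym closed emul↔ t₁ t₂ }
  ; trans = λ { {_ , t₁} {_ , t₂} {_ , t₃} → ⊢-trans closed emul⇒ t₁ t₂ t₃ }
  }
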